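{- Let $d\ge2$ and $S=\{01^{kd}0: k\ge0\}$ (where $1^j$ denotes $j$ consecutive $1$s). Then the Obscurer wins the two-string game for $r(S)$ from the starting position in which both strings are empty.
   Context: For a set $S$ of nonempty binary strings, $r(S)$ is the set of finite binary strings containing no element of $S$ as a contiguous substring. Two-string game for a set $R$ of binary strings: the state is two binary strings $u_1,u_2$. On each turn the Obscurer appends a letter to one of the two strings of her choice, then the Seeker appends a letter to the other. The Seeker wins if at some point (after either player's move) one of the two strings is not in $R$; the Obscurer wins if this never happens. -}

module Defs where

open import Data.Bool using (Bool; true; false)
open import Data.Nat using (ℕ; zero; suc; _*_)
open import Data.List using (List; []; _∷_; _++_; _∷ʳ_; replicate; foldl)
open import Data.Product using (Σ; ∃; _×_; _,_; proj₁; proj₂)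
open import Relation.Binary.PropositionalEquality using (_≡_)
open import Relation.Nullary using (¬_)

-- Binary strings: lists of bits; false = 0, true = 1.
BinStr : Set
BinStr = List Bool

Factor : BinStr → BinStr → Set
Factor s w = ∃ λ xs → ∃ λ ys → w ≡ xs ++ (s ++ ys)

patt : ℕ → ℕ → BinStr
patt d k = false ∷ (replicate (k * d) true ++ (false ∷ []))

InS : ℕ → BinStr → Set
InS d s = ∃ λ k → s ≡ patt d k

InR : ℕ → BinStr → Set
InR d w = ∀ s → InS d s → ¬ Factor s w

data Side : Set where
  first second : Side

Pos : Set
Pos = BinStr × BinStr

start : Pos
start = ([] , [])

appendAt : Side → Bool → Pos → Pos
appendAt first  a (u₁ , u₂) = (u₁ ∷ʳ a , u₂)
appendAt second a (u₁ , u₂) = (u₁ , u₂ ∷ʳ a)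

other : Side → Side
other first  = second
other second = first

-- A round: Obscurer chooses a side and a letter; Seeker's letter goes to the other side.
Round : Set
Round = Side × Bool × Bool

applyRound : Pos → Round → Pos
applyRound p (i , a , b) = appendAt (other i) b (appendAt i a p)

History : Set
History = List Round

posOf : Pos → History → Pos
posOf p h = foldl applyRound p h

ObscurerStrategy : Set
ObscurerStrategy = History → Side × Bool

SeekerStrategy : Set
SeekerStrategy = History → Side × Bool → Bool

play : ObscurerStrategy → SeekerStrategy → ℕ → History
play σ τ zero = []
play σ τ (suc n) =
  let h = play σ τ n
      m = σ h
  in h ∷ʳ (proj₁ m , proj₂ m , τ h m)

PosInR : ℕ → Pos → Set
PosInR d (u₁ , u₂) = InR d u₁ × InR d u₂

ObscurerWins : ℕ → Pos → Set
ObscurerWins d p =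
  Σ ObscurerStrategy λ σ → ∀ (τ : SeekerStrategy) (n : ℕ) →
    let h = play σ τ n
        q = posOf p h
        m = σ h
    in PosInR d q × PosInR d (appendAt (proj₁ m) (proj₂ m) q)

-- The Obscurer always appends a 1. A string leaves r(S) only when a 0 is appended while it ends
-- in 0 1^(kd), i.e. while the number of 1s after its last 0 is divisible by d. She keeps the
-- residues mod d of these two counts distinct, so at most one string is in danger. She puts her 1
-- on the dangerous string if there is one (as d ≥ 2 it then has residue 1), and otherwise on a
-- string whose residue is not d − 1. The Seeker either resets his string to residue 0, which
-- differs from the nonzero residue she just created, or shifts it by one as she shifted hers.
module Submission where

open import Defs
open import Data.Bool using (Bool; true; false)
open import Data.Empty using (⊥)
open import Data.List using ([]; _∷_; _++_; _∷ʳ_; replicate; foldl; initLast; _∷ʳ′_)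
open import Data.List.Properties using (foldl-++; foldl-∷ʳ; ∷ʳ-injective; ∷ʳ-injectiveˡ; ++-assoc; ++-identityʳ)
open import Data.Maybe using (Maybe; just; nothing)
import Data.Maybe as Maybe
open import Data.Nat using (ℕ; zero; suc; _+_; _*_; _%_; _≤_; NonZero; NonTrivial; 2+; n>1⇒nonTrivial; nonTrivial⇒nonZero)
open import Data.Nat.DivMod using (%-distribˡ-+; [m+n]%n≡m%n; m*n%n≡0; %-pred-≡0)
open import Data.Nat.Properties using (_≟_; +-suc; +-identityʳ)
open import Data.Product using (∃; _×_; _,_; proj₁)
open import Data.Sum using (_⊎_; inj₁; inj₂)
open import Data.Unit using (⊤; tt)
open import Relation.Binary.PropositionalEquality using (_≡_; _≢_; refl; sym; trans; cong; subst; subst₂)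
open import Relation.Nullary using (¬_; Dec; yes; no)

instance
  nonTrivial⇒nonZero′ : ∀ {d} .{{_ : NonTrivial d}} → NonZero d
  nonTrivial⇒nonZero′ {d} = nonTrivial⇒nonZero d

suc-%-injective : ∀ {m n d} .{{_ : NonZero d}} → suc m % d ≡ suc n % d → m % d ≡ n % d
suc-%-injective {m} {n} {d@(suc e)} eq = trans (unshift m) (trans (cong (λ r → (r + e % d) % d) eq) (sym (unshift n)))
  where
  unshift : ∀ k → k % d ≡ (suc k % d + e % d) % d
  unshift k = trans (sym ([m+n]%n≡m%n k d)) (trans (cong (_% d) (+-suc k e)) (%-distribˡ-+ (suc k) e d))

suc-%≢0 : ∀ {m d} .{{_ : NonTrivial d}} → m % d ≡ 0 → suc m % d ≢ 0
suc-%≢0 {m} {2+ e} m%d≡0 eq with trans (sym m%d≡0) (%-pred-≡0 {m} eq)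
... | ()

factor-∷ʳ : ∀ {s w b} → Factor s (w ∷ʳ b) → Factor s w ⊎ ∃ λ xs → w ∷ʳ b ≡ xs ++ s
factor-∷ʳ {s} {w} (xs , ys , eq) with initLast ys
... | [] = inj₂ (xs , trans eq (cong (xs ++_) (++-identityʳ s)))
... | ys′ ∷ʳ′ y = inj₁ (xs , ys′ , ∷ʳ-injectiveˡ w _ (trans eq regroup))
  where
  regroup : xs ++ (s ++ (ys′ ∷ʳ y)) ≡ (xs ++ (s ++ ys′)) ∷ʳ y
  regroup = trans (cong (xs ++_) (sym (++-assoc s ys′ _))) (sym (++-assoc xs _ _))

InR-[] : ∀ d → InR d []
InR-[] d s (k , refl) ([] , _ , ())
InR-[] d s (k , refl) (_ ∷ _ , _ , ())

push : Maybe ℕ → Bool → Maybe ℕ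
push _ false = just 0
push c true  = Maybe.map suc c

-- nothing while w has no 0, and afterwards just the number of 1s after its last 0
trailingOnes : BinStr → Maybe ℕ
trailingOnes = foldl push nothing

trailingOnes-∷ʳ : ∀ w b → trailingOnes (w ∷ʳ b) ≡ push (trailingOnes w) b
trailingOnes-∷ʳ w b = foldl-∷ʳ push nothing b w

push-ones : ∀ m n → foldl push (just m) (replicate n true) ≡ just (m + n)
push-ones m zero    = cong just (sym (+-identityʳ m))
push-ones m (suc n) = trans (push-ones (suc m) n) (cong just (sym (+-suc m n)))

trailingOnes-block : ∀ xs n → trailingOnes (xs ++ false ∷ replicate n true) ≡ just n
trailingOnes-block xs n = trans (foldl-++ push nothing xs _) (push-ones 0 n)

module _ (d : ℕ) .{{_ : NonZero d}} where

  Dangerous : Maybe ℕ → Set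
  Dangerous nothing  = ⊥
  Dangerous (just m) = m % d ≡ 0

  dangerous? : ∀ c → Dec (Dangerous c)
  dangerous? nothing  = no λ ()
  dangerous? (just m) = m % d ≟ 0

  block-dangerous : ∀ xs k → Dangerous (trailingOnes (xs ++ false ∷ replicate (k * d) true))
  block-dangerous xs k rewrite trailingOnes-block xs (k * d) = m*n%n≡0 k d

  InR-∷ʳ : ∀ {w b} → InR d w → (b ≡ false → ¬ Dangerous (trailingOnes w)) → InR d (w ∷ʳ b)
  InR-∷ʳ {w} w∈R safe s (k , refl) f with factor-∷ʳ f
  ... | inj₁ f′ = w∈R s (k , refl) f′
  ... | inj₂ (xs , eq)
    with refl , refl ← ∷ʳ-injective w (xs ++ false ∷ replicate (k * d) true)
                         (trans eq (sym (++-assoc xs _ _)))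
    = safe refl (block-dangerous xs k)

  PosInR-appendAt-true : ∀ i p → PosInR d p → PosInR d (appendAt i true p)
  PosInR-appendAt-true first  _ (u₁∈R , u₂∈R) = InR-∷ʳ u₁∈R (λ ()) , u₂∈R
  PosInR-appendAt-true second _ (u₁∈R , u₂∈R) = u₁∈R , InR-∷ʳ u₂∈R (λ ())

module _ (d : ℕ) .{{_ : NonTrivial d}} where

  Apart : Maybe ℕ → Maybe ℕ → Set
  Apart nothing  _        = ⊤
  Apart (just _) nothing  = ⊤
  Apart (just m) (just n) = m % d ≢ n % d

  Apart-sym : ∀ c c′ → Apart c c′ → Apart c′ c
  Apart-sym nothing  nothing  _  = tt
  Apart-sym nothing  (just _) _  = tt
  Apart-sym (just _) nothing  _  = tt
  Apart-sym (just _) (just _) ap = λ eq → ap (sym eq)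

  Apart-push : ∀ c c′ → Apart c c′ → ¬ Dangerous d (push c true) → ∀ b → Apart (push c true) (push c′ b)
  Apart-push nothing  _        _  _  _     = tt
  Apart-push (just m) _        _  ¬t false = λ eq → ¬t (trans eq (m*n%n≡0 0 d))
  Apart-push (just _) nothing  _  _  true  = tt
  Apart-push (just _) (just _) ap _  true  = λ eq → ap (suc-%-injective eq)

  Dangerous⇒¬Dangerous-push : ∀ c → Dangerous d c → ¬ Dangerous d (push c true)
  Dangerous⇒¬Dangerous-push (just _) = suc-%≢0

  Apart⇒¬Dangerous : ∀ c c′ → Apart c c′ → Dangerous d c → ¬ Dangerous d c′
  Apart⇒¬Dangerous (just _) (just _) ap m%d≡0 n%d≡0 = ap (trans m%d≡0 (sym n%d≡0))

  Apart⇒¬Dangerous-push : ∀ c c′ → Apart c c′ → Dangerous d (push c true) → ¬ Dangerous d (push c′ true)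
  Apart⇒¬Dangerous-push (just _) (just _) ap t t′ = ap (suc-%-injective (trans t (sym t′)))

  -- the Obscurer appends 1 to the string with count c, the Seeker plays on the one with count c′
  Safe : Maybe ℕ → Maybe ℕ → Set
  Safe c c′ = ¬ Dangerous d (push c true) × ¬ Dangerous d c′

  SafeAt : Side → Maybe ℕ → Maybe ℕ → Set
  SafeAt first  c₁ c₂ = Safe c₁ c₂
  SafeAt second c₁ c₂ = Safe c₂ c₁

  chooseSide : Maybe ℕ → Maybe ℕ → Side
  chooseSide c₁ c₂ with dangerous? d c₂ | dangerous? d (push c₁ true)
  ... | no _ | no _ = first
  ... | _    | _    = second

  chooseSide-safe : ∀ c₁ c₂ → Apart c₁ c₂ → SafeAt (chooseSide c₁ c₂) c₁ c₂
  chooseSide-safe c₁ c₂ ap with dangerous? d c₂ | dangerous? d (push c₁ true)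
  ... | no ¬d₂ | no ¬t₁ = ¬t₁ , ¬d₂
  ... | yes d₂ | _      = Dangerous⇒¬Dangerous-push c₂ d₂ , Apart⇒¬Dangerous c₂ c₁ (Apart-sym c₁ c₂ ap) d₂
  ... | no _   | yes t₁ = Apart⇒¬Dangerous-push c₁ c₂ ap t₁ , λ d₁ → Dangerous⇒¬Dangerous-push c₁ d₁ t₁

  Invariant : Pos → Set
  Invariant (u₁ , u₂) = PosInR d (u₁ , u₂) × Apart (trailingOnes u₁) (trailingOnes u₂)

  obscurerMove : Pos → Side × Bool
  obscurerMove (u₁ , u₂) = chooseSide (trailingOnes u₁) (trailingOnes u₂) , true

  obscurer : ObscurerStrategy
  obscurer h = obscurerMove (posOf start h)

  safe-round : ∀ {u v} → InR d u → InR d v → Apart (trailingOnes u) (trailingOnes v) →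
               Safe (trailingOnes u) (trailingOnes v) → ∀ b →
               InR d (u ∷ʳ true) × InR d (v ∷ʳ b) × Apart (trailingOnes (u ∷ʳ true)) (trailingOnes (v ∷ʳ b))
  safe-round {u} {v} u∈R v∈R ap (¬t , ¬d) b =
    InR-∷ʳ d u∈R (λ ()) , InR-∷ʳ d v∈R (λ _ → ¬d) ,
    subst₂ Apart (sym (trailingOnes-∷ʳ u true)) (sym (trailingOnes-∷ʳ v b)) (Apart-push _ _ ap ¬t b)

  Invariant-round : ∀ p b → Invariant p → Invariant (applyRound p (proj₁ (obscurerMove p) , true , b))
  Invariant-round (u₁ , u₂) b ((u₁∈R , u₂∈R) , ap)
    with chooseSide (trailingOnes u₁) (trailingOnes u₂) | chooseSide-safe _ _ ap
  ... | first  | safe = let (u₁∈R′ , u₂∈R′ , ap′) = safe-round u₁∈R u₂∈R ap safe b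
                        in (u₁∈R′ , u₂∈R′) , ap′
  ... | second | safe = let (u₂∈R′ , u₁∈R′ , ap′) = safe-round u₂∈R u₁∈R (Apart-sym _ _ ap) safe b
                        in (u₁∈R′ , u₂∈R′) , Apart-sym _ _ ap′

  Invariant-play : ∀ τ n → Invariant (posOf start (play obscurer τ n))
  Invariant-play τ zero    = (InR-[] d , InR-[] d) , tt
  Invariant-play τ (suc n) =
    subst Invariant (sym (foldl-∷ʳ applyRound start _ h)) (Invariant-round _ _ (Invariant-play τ n))
    where h = play obscurer τ n

lemma6 : (d : ℕ) → 2 ≤ d → ObscurerWins d start
lemma6 d 2≤d = obscurer d , λ τ n →
  let h = play (obscurer d) τ n
      (inR , _) = Invariant-play d τ n
  in inR , PosInR-appendAt-true d (proj₁ (obscurer d h)) (posOf start h) inR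
  where
  instance
    d>1 : NonTrivial d
    d>1 = n>1⇒nonTrivial 2≤d
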